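{- Let $G$ be a finite graph such that $\max(\alpha_M(G),\omega_M(G))\geq 2$, and let $M\subseteq V(G)$. Then $M\in\mathbb{M}(G)$ if and only if $M$ is a module of $G$ with $|M|\ge 2$, $\lambda_G(\widehat{M})\in\{\text{complete},\text{empty}\}$, and $M=\{v\in\widehat{M}:\{v\}\in\Pi(G[\widehat{M}])\}$.
   Context: Graphs are finite, simple and undirected. For $W\subseteq V(G)$, $G[W]$ is the induced subgraph. A subset $M\subseteq V(G)$ is a module of $G$ if every $v\in V(G)\setminus M$ is adjacent either to all vertices of $M$ or to none of them; the modules $\emptyset$, $V(G)$ and singletons are trivial. A graph is prime if it has at least 4 vertices and all its modules are trivial. $\omega_M(G)$ (resp. $\alpha_M(G)$) is the largest size of a module of $G$ that is a clique (resp. stable set) in $G$. $\mathbb{M}(G)$ is the family of inclusion-maximal elements among the modules of $G$ of size at least $2$ which are cliques or stable sets in $G$. A module $M$ of $G$ is strong if for every module $N$ of $G$ with $M\cap N\neq\emptyset$ one has $M\subseteq N$ or $N\subseteq M$. For $W\subseteq V(G)$, the strong modules containing $W$ form a chain under inclusion (containing $V(G)$), and $\widehat{W}$ denotes its smallest element. For a graph $F$ with $|V(F)|\ge 2$, $\Pi(F)$ is the family of inclusion-maximal strong modules of $F$ among the nonempty strong modules distinct from $V(F)$; it is a partition of $V(F)$ into modules. For a partition $P$ of $V(F)$ into modules, the quotient $F/P$ is the graph on vertex set $P$ in which two parts are adjacent iff all their vertex pairs are adjacent in $F$. It is known that $F/\Pi(F)$ is complete, empty or prime. For a strong module $M$ of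 $G$ with $|M|\ge 2$, $\lambda_G(M)$ is "complete", "empty" or "prime" according to whether $G[M]/\Pi(G[M])$ is complete, empty or prime. -}

module Defs where

open import Data.Nat using (ℕ; _≤_; _⊔_)
open import Data.Bool using (Bool; true; false)
open import Data.Fin using (Fin)
open import Data.Fin.Subset using (Subset; _∈_; _∉_; _⊆_; _∩_; ⊤; ⁅_⁆; ∣_∣; Nonempty)
open import Data.Product using (_×_; ∃; Σ)
open import Data.Sum using (_⊎_)
open import Relation.Binary.PropositionalEquality using (_≡_; _≢_)
open import Relation.Nullary using (¬_)

record Graph (n : ℕ) : Set where
  field
    adj    : Fin n → Fin n → Bool
    sym    : ∀ x y → adj x y ≡ adj y x
    irrefl : ∀ x → adj x x ≡ false
open Graph public

module _ {n : ℕ} (G : Graph n) where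

  IsModuleIn : Subset n → Subset n → Set
  IsModuleIn W M =
    M ⊆ W ×
    (∀ v → v ∈ W → v ∉ M →
       (∀ x → x ∈ M → adj G v x ≡ true) ⊎ (∀ x → x ∈ M → adj G v x ≡ false))

  IsModule : Subset n → Set
  IsModule M = IsModuleIn ⊤ M

  IsClique : Subset n → Set
  IsClique M = ∀ x y → x ∈ M → y ∈ M → x ≢ y → adj G x y ≡ true

  IsStable : Subset n → Set
  IsStable M = ∀ x y → x ∈ M → y ∈ M → x ≢ y → adj G x y ≡ false

  IsOmegaM : ℕ → Set
  IsOmegaM k = (∃ λ M → IsModule M × IsClique M × ∣ M ∣ ≡ k)
             × (∀ M → IsModule M → IsClique M → ∣ M ∣ ≤ k)

  IsAlphaM : ℕ → Set
  IsAlphaM k = (∃ λ M → IsModule M × IsStable M × ∣ M ∣ ≡ k)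
             × (∀ M → IsModule M → IsStable M → ∣ M ∣ ≤ k)

  Cand : Subset n → Set
  Cand M = IsModule M × 2 ≤ ∣ M ∣ × (IsClique M ⊎ IsStable M)

  InBigM : Subset n → Set
  InBigM M = Cand M × (∀ N → Cand N → M ⊆ N → N ≡ M)

  IsStrongIn : Subset n → Subset n → Set
  IsStrongIn W M =
    IsModuleIn W M ×
    (∀ N → IsModuleIn W N → Nonempty (M ∩ N) → M ⊆ N ⊎ N ⊆ M)

  IsStrong : Subset n → Set
  IsStrong M = IsStrongIn ⊤ M

  IsHat : Subset n → Subset n → Set
  IsHat M H = IsStrong H × M ⊆ H × (∀ S → IsStrong S → M ⊆ S → H ⊆ S)

  PiCand : Subset n → Subset n → Set
  PiCand W P = IsStrongIn W P × Nonempty P × P ≢ W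

  InPi : Subset n → Subset n → Set
  InPi W P = PiCand W P × (∀ Q → PiCand W Q → P ⊆ Q → Q ≡ P)

  PartsAdj : Subset n → Subset n → Set
  PartsAdj P Q = ∀ x y → x ∈ P → y ∈ Q → adj G x y ≡ true

  QuotComplete : Subset n → Set
  QuotComplete W = ∀ P Q → InPi W P → InPi W Q → P ≢ Q → PartsAdj P Q

  QuotEmpty : Subset n → Set
  QuotEmpty W = ∀ P Q → InPi W P → InPi W Q → P ≢ Q → ¬ PartsAdj P Q

  LambdaCompleteOrEmpty : Subset n → Set
  LambdaCompleteOrEmpty W = QuotComplete W ⊎ QuotEmpty W

module Submission where

-- The proof rests on "cuts": A ⊆ H is a t-cut of H if every edge between A and H ∖ A has
-- adjacency value t.  Cuts are modules of G[H], closed under complement and under refinement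
-- by modules, so a minimal t-cut containing a part of Π(G[H]) is itself strong and hence equal
-- to that part.  Consequently, once H has a nontrivial t-cut, every part is a t-cut: adjacency
-- between distinct parts is constantly t, i.e. the quotient G[H]/Π(G[H]) is complete or empty.
--
-- Forward: if M is a b-homogeneous module with |M| ≥ 2 (a clique or stable set), minimality
-- of H = M̂ forces every singleton {v}, v ∈ M, to be a part, and H has a nontrivial cut (a
-- singleton if M = H, otherwise one from a maximal proper module above M, which cannot be
-- strong).  Hence adjacency between parts is constantly b; maximality of M then shows that
-- every singleton part lies in M.  Backward: if adjacency between parts is constantly b and M is
-- the set of singleton parts, M is b-homogeneous; a homogeneous module N ⊇ M lies in the strong
-- module H, and a vertex of N outside M would lie in a homogeneous part that must be a singleton.

open import Defs
open import Data.Nat using (ℕ; _≤_; _⊔_)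
open import Data.Fin using (Fin)
open import Data.Fin.Subset using (Subset; _∈_; ∣_∣; ⁅_⁆)
open import Data.Product using (_×_; ∃; ∃₂)
open import Function.Bundles using (_⇔_)

open import Data.Nat using (_<_; _∸_)
open import Data.Nat.Properties using (_<?_; ≤-trans; <-irrefl; n≮0; ∸-monoʳ-<)
open import Data.Nat.Induction using (<-wellFounded)
open import Induction.WellFounded using (Acc; acc)
open import Data.Bool using (Bool; true; false)
open import Data.Bool.Properties using (¬-not) renaming (_≟_ to _≟ᵇ_)
open import Data.Fin.Subset using (_∉_; _⊆_; _⊇_; _∩_; _∪_; ∁; ⊤; Nonempty) renaming (⊥ to ∅)
open import Data.Fin.Subset.Properties
open import Data.Vec.Properties using (≡-dec)
open import Data.Product using (_,_; proj₁; proj₂)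
open import Data.Sum using (_⊎_; inj₁; inj₂; [_,_]′)
open import Data.Empty using (⊥; ⊥-elim)
open import Function using (_∘_)
open import Relation.Nullary using (¬_; Dec; yes; no)
open import Relation.Nullary.Negation using (Stable)
open import Relation.Nullary.Decidable using (decidable-stable; _⊎-dec_)
open import Relation.Binary.PropositionalEquality
  using (_≡_; _≢_; refl; trans; cong; subst; module ≡-Reasoning) renaming (sym to ≡-sym)
open import Function.Bundles using (mk⇔; Equivalence)

-- Equality of booleans and everything about subsets of Fin n is decidable, hence stable under
-- double negation; this lets the classical case analyses of the paper conclude positive facts.
≡ᵇ-stable : ∀ {a b : Bool} → Stable (a ≡ b)
≡ᵇ-stable {a} {b} = decidable-stable (a ≟ᵇ b)

module _ {n : ℕ} where

  _≟ₛ_ : (p q : Subset n) → Dec (p ≡ q)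
  _≟ₛ_ = ≡-dec _≟ᵇ_

  ∈-stable : ∀ {x : Fin n} {p : Subset n} → Stable (x ∈ p)
  ∈-stable {x} {p} = decidable-stable (x ∈? p)

  ≡ₛ-stable : ∀ {p q : Subset n} → Stable (p ≡ q)
  ≡ₛ-stable {p} {q} = decidable-stable (p ≟ₛ q)

  ⊈-witness : ∀ {p q : Subset n} → ¬ p ⊆ q → ¬ ¬ (∃ λ x → x ∈ p × x ∉ q)
  ⊈-witness p⊈q no-witness = p⊈q λ {x} x∈p → ∈-stable λ x∉q → no-witness (x , x∈p , x∉q)

  another-element : ∀ {M : Subset n} → 2 ≤ ∣ M ∣ → ∀ u → ¬ ¬ (∃ λ u' → u' ∈ M × u' ≢ u)
  another-element {M} two u none =
    <-irrefl refl (≤-trans two (subst (∣ M ∣ ≤_) (∣⁅x⁆∣≡1 u) (p⊆q⇒∣p∣≤∣q∣ M⊆⁅u⁆)))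
    where
    M⊆⁅u⁆ : M ⊆ ⁅ u ⁆
    M⊆⁅u⁆ {z} z∈M = ∈-stable λ z∉⁅u⁆ → none (z , z∈M , x∉⁅y⁆⇒x≢y z∉⁅u⁆)

  two-elements : ∀ {M : Subset n} → 2 ≤ ∣ M ∣
               → ¬ ¬ (∃₂ λ u u' → u ∈ M × u' ∈ M × u' ≢ u)
  two-elements {M} two k = some-element λ (u , u∈M) →
    another-element two u λ (u' , u'∈M , u'≢u) → k (u , u' , u∈M , u'∈M , u'≢u)
    where
    some-element : ¬ ¬ (∃ λ u → u ∈ M)
    some-element none =
      n≮0 (≤-trans two (subst (∣ M ∣ ≤_) (∣⊥∣≡0 n) (p⊆q⇒∣p∣≤∣q∣ M⊆∅)))
      where
      M⊆∅ : M ⊆ ∅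
      M⊆∅ {z} z∈M = ⊥-elim (none (z , z∈M))

  module Descent (_≼_ : Subset n → Subset n → Set)
                 (≼-refl : ∀ {A} → A ≼ A) (≼-trans : ∀ {A B C} → A ≼ B → B ≼ C → A ≼ C)
                 (μ : Subset n → ℕ) (descends : ∀ {A B} → B ≼ A → B ≢ A → μ B < μ A) where

    minimal-≼ : (Q : Subset n → Set) → ∀ {A₀} → Q A₀
              → ¬ ¬ (∃ λ A → Q A × A ≼ A₀ × (∀ B → Q B → B ≼ A → B ≡ A))
    minimal-≼ Q {A₀} qA₀ = descend A₀ (<-wellFounded (μ A₀)) qA₀ ≼-refl
      where
      descend : ∀ A → Acc _<_ (μ A) → Q A → A ≼ A₀
              → ¬ ¬ (∃ λ A → Q A × A ≼ A₀ × (∀ B → Q B → B ≼ A → B ≡ A))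
      descend A (acc smaller) qA A≼A₀ k = k (A , qA , A≼A₀ , minimal)
        where
        minimal : ∀ B → Q B → B ≼ A → B ≡ A
        minimal B qB B≼A = ≡ₛ-stable λ B≢A →
          descend B (smaller (descends B≼A B≢A)) qB (≼-trans B≼A A≼A₀) k

  ⊂-shrinks : ∀ {A B : Subset n} → B ⊆ A → B ≢ A → ∣ B ∣ < ∣ A ∣
  ⊂-shrinks {A} {B} B⊆A B≢A = decidable-stable (∣ B ∣ <? ∣ A ∣) λ ≮ →
    ⊈-witness (λ A⊆B → B≢A (⊆-antisym B⊆A A⊆B)) λ (x , x∈A , x∉B) →
    ≮ (p⊂q⇒∣p∣<∣q∣ (B⊆A , x , x∈A , x∉B))

  minimal-below : (Q : Subset n → Set) → ∀ {A₀} → Q A₀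
                → ¬ ¬ (∃ λ A → Q A × A ⊆ A₀ × (∀ B → Q B → B ⊆ A → B ≡ A))
  minimal-below = Descent.minimal-≼ _⊆_ ⊆-refl ⊆-trans ∣_∣ ⊂-shrinks

  maximal-above : (Q : Subset n → Set) → ∀ {A₀} → Q A₀
                → ¬ ¬ (∃ λ A → Q A × A₀ ⊆ A × (∀ B → Q B → A ⊆ B → B ≡ A))
  maximal-above = Descent.minimal-≼ _⊇_ ⊆-refl (λ C⊆B B⊆A → ⊆-trans B⊆A C⊆B) (λ A → n ∸ ∣ A ∣)
    λ {A} {B} A⊆B B≢A → ∸-monoʳ-< (⊂-shrinks A⊆B (B≢A ∘ ≡-sym)) (∣p∣≤n B)

  ⁅⁆⊆ : ∀ {x : Fin n} {p} → x ∈ p → ⁅ x ⁆ ⊆ p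
  ⁅⁆⊆ {x} {p} x∈p z∈⁅x⁆ = subst (_∈ p) (≡-sym (x∈⁅y⁆⇒x≡y x z∈⁅x⁆)) x∈p

  pair : Fin n → Fin n → Subset n
  pair x y = ⁅ x ⁆ ∪ ⁅ y ⁆

  x∈pair : ∀ x y → x ∈ pair x y
  x∈pair x y = x∈p∪q⁺ (inj₁ (x∈⁅x⁆ x))

  y∈pair : ∀ x y → y ∈ pair x y
  y∈pair x y = x∈p∪q⁺ (inj₂ (x∈⁅x⁆ y))

  pair-elim : ∀ {x y z : Fin n} → z ∈ pair x y → z ≡ x ⊎ z ≡ y
  pair-elim {x} {y} z∈ with x∈p∪q⁻ ⁅ x ⁆ ⁅ y ⁆ z∈
  ... | inj₁ z∈⁅x⁆ = inj₁ (x∈⁅y⁆⇒x≡y x z∈⁅x⁆)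
  ... | inj₂ z∈⁅y⁆ = inj₂ (x∈⁅y⁆⇒x≡y y z∈⁅y⁆)

  pair-⊆ : ∀ {x y : Fin n} {p} → x ∈ p → y ∈ p → pair x y ⊆ p
  pair-⊆ {p = p} x∈p y∈p z∈ = [ (λ z≡x → subst (_∈ p) (≡-sym z≡x) x∈p)
                               , (λ z≡y → subst (_∈ p) (≡-sym z≡y) y∈p) ]′ (pair-elim z∈)

  -- Set difference, through the complement so that the library's membership lemmas apply.
  infixl 5 _∖_
  _∖_ : Subset n → Subset n → Subset n
  p ∖ q = p ∩ ∁ q

  ∖-intro : ∀ {x : Fin n} {p q} → x ∈ p → x ∉ q → x ∈ p ∖ q
  ∖-intro x∈p x∉q = x∈p∩q⁺ (x∈p , x∉p⇒x∈∁p x∉q)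

  ∖-elim : ∀ {x : Fin n} {p q} → x ∈ p ∖ q → x ∈ p × x ∉ q
  ∖-elim {p = p} {q} x∈ with x∈p∩q⁻ p (∁ q) x∈
  ... | x∈p , x∈∁q = x∈p , x∈∁p⇒x∉p x∈∁q

module _ {n : ℕ} (G : Graph n) where

  Uniform : Fin n → Subset n → Set
  Uniform v S = (∀ x → x ∈ S → adj G v x ≡ true) ⊎ (∀ x → x ∈ S → adj G v x ≡ false)

  uniform : ∀ {v S} (c : Bool) → (∀ x → x ∈ S → adj G v x ≡ c) → Uniform v S
  uniform true  sees = inj₁ sees
  uniform false sees = inj₂ sees

  uniform-⊆ : ∀ {v S T} → Uniform v S → T ⊆ S → Uniform v T
  uniform-⊆ (inj₁ all)  T⊆S = inj₁ λ x x∈T → all x (T⊆S x∈T)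
  uniform-⊆ (inj₂ none) T⊆S = inj₂ λ x x∈T → none x (T⊆S x∈T)

  module-same-adj : ∀ {W S v x y} → IsModuleIn G W S → v ∈ W → v ∉ S → x ∈ S → y ∈ S
                  → adj G v x ≡ adj G v y
  module-same-adj (_ , outside) v∈W v∉S x∈S y∈S with outside _ v∈W v∉S
  ... | inj₁ all  = trans (all _ x∈S) (≡-sym (all _ y∈S))
  ... | inj₂ none = trans (none _ x∈S) (≡-sym (none _ y∈S))

  Homogeneous : Bool → Subset n → Set
  Homogeneous b M = ∀ x y → x ∈ M → y ∈ M → x ≢ y → adj G x y ≡ b

  homogeneous-value : ∀ {M} → IsClique G M ⊎ IsStable G M → ∃ λ b → Homogeneous b M
  homogeneous-value (inj₁ clique) = true , clique
  homogeneous-value (inj₂ stable) = false , stable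

  clique-or-stable : ∀ {M} b → Homogeneous b M → IsClique G M ⊎ IsStable G M
  clique-or-stable true  clique = inj₁ clique
  clique-or-stable false stable = inj₂ stable

  module-restrict : ∀ {W S} → IsModule G S → S ⊆ W → IsModuleIn G W S
  module-restrict (_ , outside) S⊆W = S⊆W , λ v _ v∉S → outside v ∈⊤ v∉S

  homogeneous-submodule : ∀ {b N S} → IsModule G N → Homogeneous b N → S ⊆ N → IsModule G S
  homogeneous-submodule {b} {N} {S} (_ , outside) homN S⊆N = ⊆⊤ , seen
    where
    seen : ∀ v → v ∈ ⊤ → v ∉ S → Uniform v S
    seen v _ v∉S with v ∈? N
    ... | yes v∈N = uniform b λ z z∈S → homN v z v∈N (S⊆N z∈S) λ v≡z →
                      v∉S (subst (_∈ S) (≡-sym v≡z) z∈S)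
    ... | no  v∉N = uniform-⊆ (outside v ∈⊤ v∉N) S⊆N

  overlapping-union : ∀ {W P N} → IsModuleIn G W P → IsModuleIn G W N → Nonempty (P ∩ N)
                    → IsModuleIn G W (P ∪ N)
  overlapping-union {W} {P} {N} mP mN (w , w∈P∩N) = P∪N⊆W , seen
    where
    P∪N⊆W : P ∪ N ⊆ W
    P∪N⊆W z∈ = [ proj₁ mP , proj₁ mN ]′ (x∈p∪q⁻ P N z∈)
    seen : ∀ v → v ∈ W → v ∉ P ∪ N → Uniform v (P ∪ N)
    seen v v∈W v∉ = uniform (adj G v w) λ z z∈ →
      [ (λ z∈P → module-same-adj mP v∈W (v∉ ∘ x∈p∪q⁺ ∘ inj₁) z∈P (proj₁ (x∈p∩q⁻ P N w∈P∩N)))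
      , (λ z∈N → module-same-adj mN v∈W (v∉ ∘ x∈p∪q⁺ ∘ inj₂) z∈N (proj₂ (x∈p∩q⁻ P N w∈P∩N))) ]′
      (x∈p∪q⁻ P N z∈)

  strong-transitive : ∀ {H P} → IsStrong G H → IsStrongIn G H P → IsStrong G P
  strong-transitive {H} {P} ((_ , H-outside) , H-strong) ((P⊆H , P-outside) , P-strong) =
    (⊆⊤ , seen) , comparable
    where
    seen : ∀ v → v ∈ ⊤ → v ∉ P → Uniform v P
    seen v _ v∉P with v ∈? H
    ... | yes v∈H = P-outside v v∈H v∉P
    ... | no  v∉H = uniform-⊆ (H-outside v ∈⊤ v∉H) P⊆H
    comparable : ∀ N → IsModule G N → Nonempty (P ∩ N) → P ⊆ N ⊎ N ⊆ P
    comparable N mN (x , x∈P∩N) with x∈p∩q⁻ P N x∈P∩N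
    ... | x∈P , x∈N with H-strong N mN (x , x∈p∩q⁺ (P⊆H x∈P , x∈N))
    ...   | inj₁ H⊆N = inj₁ (H⊆N ∘ P⊆H)
    ...   | inj₂ N⊆H = P-strong N (module-restrict mN N⊆H) (x , x∈P∩N)

  singleton-strong : ∀ {W v} → v ∈ W → IsStrongIn G W ⁅ v ⁆
  singleton-strong {W} {v} v∈W = (⁅⁆⊆ v∈W , seen) , contained
    where
    seen : ∀ w → w ∈ W → w ∉ ⁅ v ⁆ → Uniform w ⁅ v ⁆
    seen w _ _ = uniform (adj G w v) λ z z∈⁅v⁆ → cong (adj G w) (x∈⁅y⁆⇒x≡y v z∈⁅v⁆)
    contained : ∀ N → IsModuleIn G W N → Nonempty (⁅ v ⁆ ∩ N) → ⁅ v ⁆ ⊆ N ⊎ N ⊆ ⁅ v ⁆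
    contained N _ (x , x∈⁅v⁆∩N) with x∈p∩q⁻ ⁅ v ⁆ N x∈⁅v⁆∩N
    ... | x∈⁅v⁆ , x∈N = inj₁ (⁅⁆⊆ (subst (_∈ N) (x∈⁅y⁆⇒x≡y v x∈⁅v⁆) x∈N))

  part-module : ∀ {W P} → InPi G W P → IsModuleIn G W P
  part-module (((P-module , _) , _) , _) = P-module

  part-⊆ : ∀ {W P} → InPi G W P → P ⊆ W
  part-⊆ iP = proj₁ (part-module iP)

  part-nonempty : ∀ {W P} → InPi G W P → Nonempty P
  part-nonempty ((_ , P-nonempty , _) , _) = P-nonempty

  parts-disjoint : ∀ {W P Q x} → InPi G W P → InPi G W Q → P ≢ Q → x ∈ P → x ∉ Q
  parts-disjoint {Q = Q} iP@(((_ , P-strong) , _) , P-maximal) iQ@(cQ , Q-maximal) P≢Q x∈P x∈Q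
    with P-strong Q (part-module iQ) (_ , x∈p∩q⁺ (x∈P , x∈Q))
  ... | inj₁ P⊆Q = P≢Q (≡-sym (P-maximal Q cQ P⊆Q))
  ... | inj₂ Q⊆P = P≢Q (Q-maximal _ (proj₁ iP) Q⊆P)

  part-at-singleton : ∀ {W P u} → InPi G W ⁅ u ⁆ → InPi G W P → u ∈ P → P ≡ ⁅ u ⁆
  part-at-singleton (_ , u-maximal) (cP , _) u∈P = u-maximal _ cP (⁅⁆⊆ u∈P)

  part-containing : ∀ {W w h} → w ∈ W → h ∈ W → h ≢ w → ¬ ¬ (∃ λ R → InPi G W R × w ∈ R)
  part-containing {W} {w} {h} w∈W h∈W h≢w k =
    maximal-above (PiCand G W) (singleton-strong w∈W , (w , x∈⁅x⁆ w) , ⁅w⁆≢W)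
      λ (R , cR , ⁅w⁆⊆R , R-maximal) → k (R , (cR , R-maximal) , ⁅w⁆⊆R (x∈⁅x⁆ w))
    where
    ⁅w⁆≢W : ⁅ w ⁆ ≢ W
    ⁅w⁆≢W ⁅w⁆≡W = h≢w (x∈⁅y⁆⇒x≡y w (subst (h ∈_) (≡-sym ⁅w⁆≡W) h∈W))

  parts-adjacency-constant : ∀ {W P Q x y x' y'} → InPi G W P → InPi G W Q → P ≢ Q
                           → x ∈ P → y ∈ Q → x' ∈ P → y' ∈ Q → adj G x' y' ≡ adj G x y
  parts-adjacency-constant {P = P} {Q} {x} {y} {x'} {y'} iP iQ P≢Q x∈P y∈Q x'∈P y'∈Q = begin
    adj G x' y' ≡⟨ sym G x' y' ⟩
    adj G y' x' ≡⟨ module-same-adj (part-module iP) (part-⊆ iQ y'∈Q) y'∉P x'∈P x∈P ⟩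
    adj G y' x  ≡⟨ sym G y' x ⟩
    adj G x y'  ≡⟨ module-same-adj (part-module iQ) (part-⊆ iP x∈P) x∉Q y'∈Q y∈Q ⟩
    adj G x y   ∎
    where
    open ≡-Reasoning
    y'∉P : y' ∉ P
    y'∉P = parts-disjoint iQ iP (P≢Q ∘ ≡-sym) y'∈Q
    x∉Q : x ∉ Q
    x∉Q = parts-disjoint iP iQ P≢Q x∈P

  -- The quotient G[W]/Π(G[W]) is complete (b = true) or empty (b = false): every vertex of a
  -- part has adjacency value b to every vertex of W outside that part.
  UniformQuotient : Bool → Subset n → Set
  UniformQuotient b W = ∀ {P x y} → InPi G W P → x ∈ P → y ∈ W → y ∉ P → adj G x y ≡ b

  across-parts : ∀ {b W P Q x y} → UniformQuotient b W → InPi G W P → InPi G W Q → P ≢ Q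
               → x ∈ P → y ∈ Q → adj G x y ≡ b
  across-parts unif iP iQ P≢Q x∈P y∈Q =
    unif iP x∈P (part-⊆ iQ y∈Q) (parts-disjoint iQ iP (P≢Q ∘ ≡-sym) y∈Q)

  empty-quotient : ∀ {W P Q} → UniformQuotient false W → InPi G W P → InPi G W Q → P ≢ Q
                 → ¬ PartsAdj G P Q
  empty-quotient unif iP iQ P≢Q adjacent with part-nonempty iP | part-nonempty iQ
  ... | x , x∈P | y , y∈Q
    with trans (≡-sym (adjacent x y x∈P y∈Q)) (across-parts unif iP iQ P≢Q x∈P y∈Q)
  ... | ()

  uniform⇒λ : ∀ {b W} → UniformQuotient b W → LambdaCompleteOrEmpty G W
  uniform⇒λ {true}  unif = inj₁ λ P Q iP iQ P≢Q x y x∈P y∈Q → across-parts unif iP iQ P≢Q x∈P y∈Q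
  uniform⇒λ {false} unif = inj₂ λ P Q iP iQ P≢Q → empty-quotient unif iP iQ P≢Q

  λ⇒uniform : ∀ {W} → LambdaCompleteOrEmpty G W → ∃ λ b → UniformQuotient b W
  λ⇒uniform {W} lce = value lce , λ {P} {x} {y} iP x∈P y∈W y∉P → ≡ᵇ-stable λ ≢value →
    part-containing y∈W (part-⊆ iP x∈P) (λ x≡y → y∉P (subst (_∈ P) x≡y x∈P)) λ (Q , iQ , y∈Q) →
    ≢value (between lce iP iQ (λ P≡Q → y∉P (subst (y ∈_) (≡-sym P≡Q) y∈Q)) x∈P y∈Q)
    where
    value : LambdaCompleteOrEmpty G W → Bool
    value (inj₁ _) = true
    value (inj₂ _) = false
    between : (lce : LambdaCompleteOrEmpty G W) → ∀ {P Q x y} → InPi G W P → InPi G W Q → P ≢ Q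
            → x ∈ P → y ∈ Q → adj G x y ≡ value lce
    between (inj₁ complete) iP iQ P≢Q x∈P y∈Q = complete _ _ iP iQ P≢Q _ _ x∈P y∈Q
    between (inj₂ empty)    iP iQ P≢Q x∈P y∈Q = ¬-not λ adjacent → empty _ _ iP iQ P≢Q
      λ x' y' x'∈P y'∈Q → trans (parts-adjacency-constant iP iQ P≢Q x∈P y∈Q x'∈P y'∈Q) adjacent

  singleton-parts-module : ∀ {b H Z} → IsModule G H → UniformQuotient b H → Z ⊆ H
                         → (∀ {z} → z ∈ Z → InPi G H ⁅ z ⁆) → IsModule G Z × Homogeneous b Z
  singleton-parts-module {b} {H} {Z} (_ , H-outside) unif Z⊆H singleton = (⊆⊤ , seen) , homogeneous
    where
    homogeneous : Homogeneous b Z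
    homogeneous x y x∈Z y∈Z x≢y =
      unif (singleton x∈Z) (x∈⁅x⁆ x) (Z⊆H y∈Z) (x≢y ∘ ≡-sym ∘ x∈⁅y⁆⇒x≡y x)
    seen : ∀ w → w ∈ ⊤ → w ∉ Z → Uniform w Z
    seen w _ w∉Z with w ∈? H
    ... | no  w∉H = uniform-⊆ (H-outside w ∈⊤ w∉H) Z⊆H
    ... | yes w∈H = uniform b λ z z∈Z → trans (sym G w z) (unif (singleton z∈Z) (x∈⁅x⁆ z) w∈H λ w∈⁅z⁆ →
                      w∉Z (subst (_∈ Z) (≡-sym (x∈⁅y⁆⇒x≡y z w∈⁅z⁆)) z∈Z))

  -- A homogeneous module of G sharing a vertex u with a strong module H ∋ u' ≠ u lies in H:
  -- otherwise a pair {v, u} with v ∉ H would be a module overlapping H.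
  homogeneous-within-strong : ∀ {b H N u u'} → IsStrong G H → IsModule G N → Homogeneous b N
                            → u ∈ N → u ∈ H → u' ∈ H → u' ≢ u → N ⊆ H
  homogeneous-within-strong {H = H} {u = u} {u'} (_ , H-strong) mN homN u∈N u∈H u'∈H u'≢u {v} v∈N =
    ∈-stable λ v∉H →
    [ (λ H⊆vu → [ (λ u'≡v → v∉H (subst (_∈ H) u'≡v u'∈H)) , u'≢u ]′ (pair-elim (H⊆vu u'∈H)))
    , (λ vu⊆H → v∉H (vu⊆H (x∈pair v u))) ]′
    (H-strong (pair v u) (homogeneous-submodule mN homN (pair-⊆ v∈N u∈N))
              (u , x∈p∩q⁺ (u∈H , y∈pair v u)))

  -- In a b-uniform quotient, a b-homogeneous part P is a singleton as soon as some singleton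
  -- part {u} lies outside it: for v ∈ P, the pair {v, u} is a module overlapping P.
  homogeneous-part-singleton : ∀ {b W P u v} → UniformQuotient b W → InPi G W P → Homogeneous b P
                             → InPi G W ⁅ u ⁆ → u ∉ P → v ∈ P → P ≡ ⁅ v ⁆
  homogeneous-part-singleton {b} {W} {P} {u} {v} unif iP@(((_ , P-strong) , _) , _) homP iu u∉P v∈P =
    ⊆-antisym P⊆⁅v⁆ (⁅⁆⊆ v∈P)
    where
    u∈W : u ∈ W
    u∈W = part-⊆ iu (x∈⁅x⁆ u)
    v∈W : v ∈ W
    v∈W = part-⊆ iP v∈P
    sees-pair : ∀ w → w ∈ W → w ∉ pair v u → ∀ z → z ∈ pair v u → adj G w z ≡ b
    sees-pair w w∈W w∉ z z∈ with pair-elim z∈ | w ∈? P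
    ... | inj₁ refl | yes w∈P = homP w v w∈P v∈P λ w≡v →
                                  w∉ (subst (_∈ pair v u) (≡-sym w≡v) (x∈pair v u))
    ... | inj₁ refl | no  w∉P = trans (sym G w v) (unif iP v∈P w∈W w∉P)
    ... | inj₂ refl | _       = trans (sym G w u) (unif iu (x∈⁅x⁆ u) w∈W λ w∈⁅u⁆ →
                                  w∉ (subst (_∈ pair v u) (≡-sym (x∈⁅y⁆⇒x≡y u w∈⁅u⁆)) (y∈pair v u)))
    pair-module : IsModuleIn G W (pair v u)
    pair-module = pair-⊆ v∈W u∈W , λ w w∈W w∉ → uniform b (sees-pair w w∈W w∉)
    P⊆⁅v⁆ : P ⊆ ⁅ v ⁆
    P⊆⁅v⁆ {p} p∈P with P-strong (pair v u) pair-module (v , x∈p∩q⁺ (v∈P , x∈pair v u))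
    ... | inj₂ vu⊆P = ⊥-elim (u∉P (vu⊆P (y∈pair v u)))
    ... | inj₁ P⊆vu = [ (λ p≡v → subst (_∈ ⁅ v ⁆) (≡-sym p≡v) (x∈⁅x⁆ v))
                      , (λ p≡u → ⊥-elim (u∉P (subst (_∈ P) p≡u p∈P))) ]′ (pair-elim (P⊆vu p∈P))

  Cut : Subset n → Bool → Subset n → Set
  Cut W t A = A ⊆ W × (∀ a z → a ∈ A → z ∈ W → z ∉ A → adj G a z ≡ t)

  NontrivialCut : Subset n → Bool → Subset n → Set
  NontrivialCut W t A = Cut W t A × Nonempty A × ∃ λ z → z ∈ W × z ∉ A

  cut-module : ∀ {W t A} → Cut W t A → IsModuleIn G W A
  cut-module {t = t} (A⊆W , crossing) =
    A⊆W , λ v v∈W v∉A → uniform t λ a a∈A → trans (sym G v a) (crossing a v a∈A v∈W v∉A)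

  cut-complement : ∀ {W t A} → Cut W t A → Cut W t (W ∖ A)
  cut-complement {W} {t} {A} (_ , crossing) = proj₁ ∘ ∖-elim , crossing′
    where
    crossing′ : ∀ a z → a ∈ W ∖ A → z ∈ W → z ∉ W ∖ A → adj G a z ≡ t
    crossing′ a z a∈ z∈W z∉ with ∖-elim a∈
    ... | a∈W , a∉A = trans (sym G a z) (crossing z a (∈-stable (z∉ ∘ ∖-intro z∈W)) a∈W a∉A)

  cut-refine : ∀ {W t A N u} → Cut W t A → IsModuleIn G W N → u ∈ N → u ∉ A
             → Cut W t (A ∩ N) × Cut W t (A ∖ N)
  cut-refine {W} {t} {A} {N} {u} (A⊆W , crossing) mN u∈N u∉A =
    (A⊆W ∘ proj₁ ∘ x∈p∩q⁻ A N , inside) , (A⊆W ∘ proj₁ ∘ ∖-elim , outside)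
    where
    u∈W : u ∈ W
    u∈W = proj₁ mN u∈N
    inside : ∀ a z → a ∈ A ∩ N → z ∈ W → z ∉ A ∩ N → adj G a z ≡ t
    inside a z a∈ z∈W z∉ with x∈p∩q⁻ A N a∈ | z ∈? A
    ... | _ , _ | no z∉A = crossing a z (proj₁ (x∈p∩q⁻ A N a∈)) z∈W z∉A
    ... | _ , a∈N | yes z∈A = begin
      adj G a z ≡⟨ sym G a z ⟩
      adj G z a ≡⟨ module-same-adj mN z∈W (z∉ ∘ x∈p∩q⁺ ∘ (z∈A ,_)) a∈N u∈N ⟩
      adj G z u ≡⟨ crossing z u z∈A u∈W u∉A ⟩
      t         ∎
      where open ≡-Reasoning
    outside : ∀ a z → a ∈ A ∖ N → z ∈ W → z ∉ A ∖ N → adj G a z ≡ t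
    outside a z a∈ z∈W z∉ with ∖-elim a∈ | z ∈? A
    ... | a∈A , _ | no z∉A = crossing a z a∈A z∈W z∉A
    ... | a∈A , a∉N | yes z∈A = begin
      adj G a z ≡⟨ module-same-adj mN (A⊆W a∈A) a∉N (∈-stable (z∉ ∘ ∖-intro z∈A)) u∈N ⟩
      adj G a u ≡⟨ crossing a u a∈A u∈W u∉A ⟩
      t         ∎
      where open ≡-Reasoning

  -- A proper strong module of G[W] meeting a cut lies inside it, since the cut and its
  -- complement are modules covering W.
  strong-within-cut : ∀ {W t A P x} → IsStrongIn G W P → P ≢ W → Cut W t A → x ∈ P → x ∈ A → P ⊆ A
  strong-within-cut {W} {A = A} {P} {x} ((P⊆W , _) , P-strong) P≢W cut x∈P x∈A {y} y∈P =
    ∈-stable λ y∉A →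
    [ (λ (P⊆A : P ⊆ A) → y∉A (P⊆A y∈P))
    , (λ (A⊆P : A ⊆ P) → [ (λ (P⊆Ā : P ⊆ W ∖ A) → proj₂ (∖-elim (P⊆Ā x∈P)) x∈A)
                         , (λ (Ā⊆P : W ∖ A ⊆ P) → P≢W (⊆-antisym P⊆W (W⊆P A⊆P Ā⊆P))) ]′
                         (P-strong (W ∖ A) (cut-module (cut-complement cut))
                                   (y , x∈p∩q⁺ (y∈P , ∖-intro (P⊆W y∈P) y∉A))))
    ]′ (P-strong A (cut-module cut) (x , x∈p∩q⁺ (x∈P , x∈A)))
    where
    W⊆P : A ⊆ P → W ∖ A ⊆ P → W ⊆ P
    W⊆P A⊆P Ā⊆P {h} h∈W = ∈-stable λ h∉P → h∉P (Ā⊆P (∖-intro h∈W (h∉P ∘ A⊆P)))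

  -- A t-cut that is minimal among the t-cuts containing a nonempty proper strong module P is
  -- strong: an overlapping module N would refine it into two smaller t-cuts, one containing P.
  minimal-cut-strong : ∀ {W t A P} → IsStrongIn G W P → P ≢ W → Nonempty P → Cut W t A → P ⊆ A
                     → (∀ B → Cut W t B × P ⊆ B → B ⊆ A → B ≡ A) → IsStrongIn G W A
  minimal-cut-strong {W} {t} {A} {P} sP P≢W (p , p∈P) cut P⊆A minimal = cut-module cut , comparable
    where
    refined-too-small : ∀ {N u w c} → IsModuleIn G W N → u ∈ N → u ∉ A → w ∈ A → w ∉ N
                      → c ∈ A → c ∈ N → ⊥
    refined-too-small {N} mN u∈N u∉A w∈A w∉N c∈A c∈N with cut-refine cut mN u∈N u∉A | p ∈? N
    ... | cut∩ , _ | yes p∈N = w∉N (proj₂ (x∈p∩q⁻ A N (subst (_ ∈_) (≡-sym A∩N≡A) w∈A)))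
      where
      A∩N≡A : A ∩ N ≡ A
      A∩N≡A = minimal (A ∩ N) (cut∩ , strong-within-cut sP P≢W cut∩ p∈P (x∈p∩q⁺ (P⊆A p∈P , p∈N)))
                      (p∩q⊆p A N)
    ... | _ , cut∖ | no p∉N = proj₂ (∖-elim (subst (_ ∈_) (≡-sym A∖N≡A) c∈A)) c∈N
      where
      A∖N≡A : A ∖ N ≡ A
      A∖N≡A = minimal (A ∖ N) (cut∖ , strong-within-cut sP P≢W cut∖ p∈P (∖-intro (P⊆A p∈P) p∉N))
                      (proj₁ ∘ ∖-elim)
    comparable : ∀ N → IsModuleIn G W N → Nonempty (A ∩ N) → A ⊆ N ⊎ N ⊆ A
    comparable N mN (c , c∈A∩N) = decidable-stable ((A ⊆? N) ⊎-dec (N ⊆? A)) λ incomparable →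
      ⊈-witness (incomparable ∘ inj₁) λ (w , w∈A , w∉N) →
      ⊈-witness (incomparable ∘ inj₂) λ (u , u∈N , u∉A) →
      refined-too-small mN u∈N u∉A w∈A w∉N (proj₁ (x∈p∩q⁻ A N c∈A∩N)) (proj₂ (x∈p∩q⁻ A N c∈A∩N))

  -- A part lying inside a proper t-cut is itself a t-cut: the minimal t-cut between them is a
  -- strong proper module containing the part, hence equal to it.
  part-cut-within : ∀ {W t A₁ P z} → InPi G W P → Cut W t A₁ → P ⊆ A₁ → z ∈ W → z ∉ A₁
                  → ¬ ¬ Cut W t P
  part-cut-within {W} {t} {P = P} iP@((sP , (p , p∈P) , P≢W) , P-maximal) cut₁ P⊆A₁ z∈W z∉A₁ k =
    minimal-below (λ B → Cut W t B × P ⊆ B) (cut₁ , P⊆A₁) λ (A , (cut , P⊆A) , A⊆A₁ , minimal) →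
      let A-part : PiCand G W A
          A-part = minimal-cut-strong sP P≢W (p , p∈P) cut P⊆A minimal , (p , P⊆A p∈P)
                 , λ A≡W → z∉A₁ (A⊆A₁ (subst (_ ∈_) (≡-sym A≡W) z∈W))
      in k (subst (Cut W t) (P-maximal A A-part P⊆A) cut)

  -- If W has a nontrivial t-cut, every part of Π(G[W]) is a t-cut (it lies in the cut or in its
  -- complement), i.e. adjacency between distinct parts is constantly t.
  parts-are-cuts : ∀ {W t A P} → NontrivialCut W t A → InPi G W P → ¬ ¬ Cut W t P
  parts-are-cuts {W} {A = A} (cut , (a , a∈A) , z , z∈W , z∉A) iP@((sP , (p , p∈P) , P≢W) , _)
    with p ∈? A
  ... | yes p∈A = part-cut-within iP cut (strong-within-cut sP P≢W cut p∈P p∈A) z∈W z∉A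
  ... | no  p∉A = part-cut-within iP (cut-complement cut)
                    (strong-within-cut sP P≢W (cut-complement cut) p∈P (∖-intro (part-⊆ iP p∈P) p∉A))
                    (proj₁ cut a∈A) (λ a∈Ā → proj₂ (∖-elim a∈Ā) a∈A)

  overlap-cut : ∀ {W P N x y} → IsModuleIn G W P → IsModuleIn G W N
              → (∀ {z} → z ∈ W → z ∈ P ⊎ z ∈ N) → x ∈ P → x ∉ N → y ∈ N → y ∉ P
              → Cut W (adj G x y) (P ∖ N)
  overlap-cut {W} {P} {N} {x} {y} mP mN cover x∈P x∉N y∈N y∉P = proj₁ mP ∘ proj₁ ∘ ∖-elim , crossing
    where
    crossing : ∀ a z → a ∈ P ∖ N → z ∈ W → z ∉ P ∖ N → adj G a z ≡ adj G x y
    crossing a z a∈ z∈W z∉ with ∖-elim a∈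
    ... | a∈P , a∉N = begin
      adj G a z ≡⟨ module-same-adj mN (proj₁ mP a∈P) a∉N z∈N y∈N ⟩
      adj G a y ≡⟨ sym G a y ⟩
      adj G y a ≡⟨ module-same-adj mP (proj₁ mN y∈N) y∉P a∈P x∈P ⟩
      adj G y x ≡⟨ sym G y x ⟩
      adj G x y ∎
      where
      open ≡-Reasoning
      z∈N : z ∈ N
      z∈N = ∈-stable λ z∉N → [ z∉ ∘ (λ z∈P → ∖-intro z∈P z∉N) , z∉N ]′ (cover z∈W)

  -- A maximal proper module of G[W] that is not strong yields a nontrivial cut of W: an
  -- overlapping module N must cover W together with it.
  nonstrong-maximal-cut : ∀ {W P} → IsModuleIn G W P
    → (∀ B → IsModuleIn G W B × B ≢ W → P ⊆ B → B ≡ P)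
    → ¬ (∀ N → IsModuleIn G W N → Nonempty (P ∩ N) → P ⊆ N ⊎ N ⊆ P)
    → ¬ ¬ (∃₂ λ t A → NontrivialCut W t A)
  nonstrong-maximal-cut {W} {P} mP P-maximal nonstrong k =
    nonstrong λ N mN meets → decidable-stable ((P ⊆? N) ⊎-dec (N ⊆? P)) λ incomparable →
      ⊈-witness (incomparable ∘ inj₁) λ (x , x∈P , x∉N) →
      ⊈-witness (incomparable ∘ inj₂) λ (y , y∈N , y∉P) →
      k (adj G x y , P ∖ N , overlap-cut mP mN (cover mN meets incomparable) x∈P x∉N y∈N y∉P
        , (x , ∖-intro x∈P x∉N) , y , proj₁ mN y∈N , λ y∈ → proj₂ (∖-elim y∈) y∈N)
    where
    cover : ∀ {N} → IsModuleIn G W N → Nonempty (P ∩ N) → ¬ (P ⊆ N ⊎ N ⊆ P)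
          → ∀ {z} → z ∈ W → z ∈ P ⊎ z ∈ N
    cover {N} mN meets incomparable {z} z∈W = x∈p∪q⁻ P N (subst (z ∈_) (≡-sym P∪N≡W) z∈W)
      where
      P∪N≡W : P ∪ N ≡ W
      P∪N≡W = ≡ₛ-stable λ P∪N≢W → incomparable (inj₂ λ {v} v∈N →
        subst (v ∈_) (P-maximal (P ∪ N) (overlapping-union mP mN meets , P∪N≢W) (p⊆p∪q N))
              (q⊆p∪q P N v∈N))

module Forward {n : ℕ} (G : Graph n) {M H : Subset n} (hat : IsHat G M H)
               (mM : IsModule G M) (two : 2 ≤ ∣ M ∣) {b : Bool} (homM : Homogeneous G b M) where

  H-strong : IsStrong G H
  H-strong = proj₁ hat

  M⊆H : M ⊆ H
  M⊆H = proj₁ (proj₂ hat)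

  strong-above-M : ∀ {Q} → IsStrongIn G H Q → M ⊆ Q → Q ≡ H
  strong-above-M sQ M⊆Q =
    ⊆-antisym (proj₁ (proj₁ sQ)) (proj₂ (proj₂ hat) _ (strong-transitive G H-strong sQ) M⊆Q)

  -- A proper strong module Q of G[H] through x ∈ M is {x}: some m ∈ M lies outside Q, and the
  -- module {x, m} meets Q without being contained in it.
  strong-through-M : ∀ {Q x} → IsStrongIn G H Q → Q ≢ H → x ∈ Q → x ∈ M → Q ≡ ⁅ x ⁆
  strong-through-M {Q} {x} sQ Q≢H x∈Q x∈M = ⊆-antisym Q⊆⁅x⁆ (⁅⁆⊆ x∈Q)
    where
    pair-module : ∀ {m} → m ∈ M → IsModuleIn G H (pair x m)
    pair-module m∈M = module-restrict G (homogeneous-submodule G mM homM (pair-⊆ x∈M m∈M))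
                                        (pair-⊆ (M⊆H x∈M) (M⊆H m∈M))
    Q⊆⁅x⁆ : Q ⊆ ⁅ x ⁆
    Q⊆⁅x⁆ {y} y∈Q = ∈-stable λ y∉⁅x⁆ → ⊈-witness (Q≢H ∘ strong-above-M sQ) λ (m , m∈M , m∉Q) →
      [ (λ Q⊆xm → [ x∉⁅y⁆⇒x≢y y∉⁅x⁆ , (λ y≡m → m∉Q (subst (_∈ Q) y≡m y∈Q)) ]′ (pair-elim (Q⊆xm y∈Q)))
      , (λ xm⊆Q → m∉Q (xm⊆Q (y∈pair x m))) ]′
      (proj₂ sQ (pair x m) (pair-module m∈M) (x , x∈p∩q⁺ (x∈Q , x∈pair x m)))

  M-singleton-part : ∀ {v} → v ∈ M → InPi G H ⁅ v ⁆
  M-singleton-part {v} v∈M =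
    (singleton-strong G (M⊆H v∈M) , (v , x∈⁅x⁆ v) , ⁅v⁆≢H)
    , λ Q (sQ , _ , Q≢H) ⁅v⁆⊆Q → strong-through-M sQ Q≢H (⁅v⁆⊆Q (x∈⁅x⁆ v)) v∈M
    where
    ⁅v⁆≢H : ⁅ v ⁆ ≢ H
    ⁅v⁆≢H ⁅v⁆≡H = another-element two v λ (u , u∈M , u≢v) →
      u≢v (x∈⁅y⁆⇒x≡y v (subst (u ∈_) (≡-sym ⁅v⁆≡H) (M⊆H u∈M)))

  -- H has a nontrivial cut: a singleton if M = H; otherwise one coming from a maximal proper
  -- module of G[H] above M, which cannot be strong by strong-above-M.
  nontrivial-cut : ¬ ¬ (∃₂ λ t A → NontrivialCut G H t A)
  nontrivial-cut k with M ≟ₛ H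
  ... | yes M≡H = two-elements two λ (u , u' , u∈M , u'∈M , u'≢u) →
        k (b , ⁅ u ⁆ , (⁅⁆⊆ (M⊆H u∈M) , singleton-cut M≡H u∈M) , (u , x∈⁅x⁆ u)
          , u' , M⊆H u'∈M , u'≢u ∘ x∈⁅y⁆⇒x≡y u)
    where
    singleton-cut : M ≡ H → ∀ {u} → u ∈ M → ∀ a z → a ∈ ⁅ u ⁆ → z ∈ H → z ∉ ⁅ u ⁆ → adj G a z ≡ b
    singleton-cut M≡H {u} u∈M a z a∈⁅u⁆ z∈H z∉⁅u⁆ with x∈⁅y⁆⇒x≡y u a∈⁅u⁆
    ... | refl = homM a z u∈M (subst (z ∈_) (≡-sym M≡H) z∈H) λ a≡z →
                   z∉⁅u⁆ (subst (_∈ ⁅ a ⁆) a≡z (x∈⁅x⁆ a))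
  ... | no  M≢H = maximal-above (λ A → IsModuleIn G H A × A ≢ H) (module-restrict G mM M⊆H , M≢H)
        λ (P , (mP , P≢H) , M⊆P , P-maximal) →
        nonstrong-maximal-cut G mP P-maximal (λ P-strong → P≢H (strong-above-M (mP , P-strong) M⊆P)) k

  -- Every nontrivial cut of H has value b: the parts {u}, u ∈ M, are cuts inside M.
  cut-value : ∀ {t A} → NontrivialCut G H t A → ¬ ¬ (t ≡ b)
  cut-value cut k = two-elements two λ (u , u' , u∈M , u'∈M , u'≢u) →
    parts-are-cuts G cut (M-singleton-part u∈M) λ (_ , crossing) →
    k (trans (≡-sym (crossing u u' (x∈⁅x⁆ u) (M⊆H u'∈M) (u'≢u ∘ x∈⁅y⁆⇒x≡y u)))
             (homM u u' u∈M u'∈M (u'≢u ∘ ≡-sym)))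

  uniform-quotient : UniformQuotient G b H
  uniform-quotient {P} {x} {y} iP x∈P y∈H y∉P = ≡ᵇ-stable λ ≢b →
    nontrivial-cut λ (t , A , cut) → parts-are-cuts G cut iP λ (_ , crossing) → cut-value cut λ t≡b →
    ≢b (subst (adj G x y ≡_) t≡b (crossing x y x∈P y∈H y∉P))

  -- If M is maximal, every singleton part {v} of Π(G[H]) lies in M: M ∪ {v} consists of
  -- singleton parts, hence is a homogeneous module of size ≥ 2 containing M.
  singleton-part-in-M : (∀ N → Cand G N → M ⊆ N → N ≡ M) → ∀ {v} → v ∈ H → InPi G H ⁅ v ⁆ → v ∈ M
  singleton-part-in-M M-maximal {v} v∈H v-part =
    subst (v ∈_) (M-maximal (M ∪ ⁅ v ⁆) (proj₁ Z-module , ≤-trans two (∣p∣≤∣p∪q∣ M ⁅ v ⁆)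
                                        , clique-or-stable G b (proj₂ Z-module))
                            (p⊆p∪q ⁅ v ⁆))
          (q⊆p∪q M ⁅ v ⁆ (x∈⁅x⁆ v))
    where
    Z⊆H : M ∪ ⁅ v ⁆ ⊆ H
    Z⊆H z∈ = [ M⊆H , ⁅⁆⊆ v∈H ]′ (x∈p∪q⁻ M ⁅ v ⁆ z∈)
    singleton : ∀ {z} → z ∈ M ∪ ⁅ v ⁆ → InPi G H ⁅ z ⁆
    singleton {z} z∈ =
      [ M-singleton-part
      , (λ z∈⁅v⁆ → subst (λ z → InPi G H ⁅ z ⁆) (≡-sym (x∈⁅y⁆⇒x≡y v z∈⁅v⁆)) v-part) ]′
      (x∈p∪q⁻ M ⁅ v ⁆ z∈)
    Z-module : IsModule G (M ∪ ⁅ v ⁆) × Homogeneous G b (M ∪ ⁅ v ⁆)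
    Z-module = singleton-parts-module G (proj₁ H-strong) uniform-quotient Z⊆H singleton

module Backward {n : ℕ} (G : Graph n) {M H : Subset n} (H-strong : IsStrong G H) (M⊆H : M ⊆ H)
                (two : 2 ≤ ∣ M ∣) {b : Bool} (unif : UniformQuotient G b H)
                (singletons : ∀ v → v ∈ M ⇔ (v ∈ H × InPi G H ⁅ v ⁆)) where

  M-part : ∀ {v} → v ∈ M → InPi G H ⁅ v ⁆
  M-part v∈M = proj₂ (Equivalence.to (singletons _) v∈M)

  in-M : ∀ {v} → v ∈ H → InPi G H ⁅ v ⁆ → v ∈ M
  in-M v∈H v-part = Equivalence.from (singletons _) (v∈H , v-part)

  homM : Homogeneous G b M
  homM = proj₂ (singleton-parts-module G (proj₁ H-strong) unif M⊆H M-part)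

  module Above {N : Subset n} {c : Bool} (mN : IsModule G N) (homN : Homogeneous G c N)
               (M⊆N : M ⊆ N) where

    value-b : c ≡ b
    value-b = ≡ᵇ-stable λ c≢b → two-elements two λ (u , u' , u∈M , u'∈M , u'≢u) →
      c≢b (trans (≡-sym (homN u' u (M⊆N u'∈M) (M⊆N u∈M) u'≢u)) (homM u' u u'∈M u∈M u'≢u))

    N⊆H : N ⊆ H
    N⊆H v∈N = ∈-stable λ v∉H → two-elements two λ (u , u' , u∈M , u'∈M , u'≢u) →
      v∉H (homogeneous-within-strong G H-strong mN homN (M⊆N u∈M) (M⊆H u∈M) (M⊆H u'∈M) u'≢u v∈N)

    -- A vertex v ∈ N ∖ M cannot lie in any part P: if u ∈ M lies in P then P = {u}; if P ⊆ N
    -- then P is b-homogeneous and so a singleton part; N ⊆ P would again put u in P.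
    no-part-outside-M : ∀ {v u P} → v ∈ N → v ∉ M → u ∈ M → InPi G H P → v ∈ P → ⊥
    no-part-outside-M {v} {u} {P} v∈N v∉M u∈M iP@(((_ , P-strong) , _) , _) v∈P with u ∈? P
    ... | yes u∈P = v∉M (subst (_∈ M) (≡-sym (x∈⁅y⁆⇒x≡y u v∈⁅u⁆)) u∈M)
      where
      v∈⁅u⁆ : v ∈ ⁅ u ⁆
      v∈⁅u⁆ = subst (v ∈_) (part-at-singleton G (M-part u∈M) iP u∈P) v∈P
    ... | no u∉P with P-strong N (module-restrict G mN N⊆H) (v , x∈p∩q⁺ (v∈P , v∈N))
    ...   | inj₂ N⊆P = u∉P (N⊆P (M⊆N u∈M))
    ...   | inj₁ P⊆N = v∉M (in-M (N⊆H v∈N) (subst (InPi G H) P≡⁅v⁆ iP))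
      where
      homP : Homogeneous G b P
      homP x y x∈P y∈P = subst (adj G x y ≡_) value-b ∘ homN x y (P⊆N x∈P) (P⊆N y∈P)
      P≡⁅v⁆ : P ≡ ⁅ v ⁆
      P≡⁅v⁆ = homogeneous-part-singleton G unif iP homP (M-part u∈M) u∉P v∈P

    N⊆M : N ⊆ M
    N⊆M {v} v∈N = ∈-stable λ v∉M → two-elements two λ (u , _ , u∈M , _) →
      part-containing G (N⊆H v∈N) (M⊆H u∈M) (λ u≡v → v∉M (subst (_∈ M) u≡v u∈M))
        λ (P , iP , v∈P) → no-part-outside-M v∈N v∉M u∈M iP v∈P

  in-𝕄 : IsModule G M → InBigM G M
  in-𝕄 mM = (mM , two , clique-or-stable G b homM) , M-maximal
    where
    M-maximal : ∀ N → Cand G N → M ⊆ N → N ≡ M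
    M-maximal N (mN , _ , N-shape) M⊆N =
      ⊆-antisym (Above.N⊆M mN (proj₂ (homogeneous-value G N-shape)) M⊆N) M⊆N

proposition6 : ∀ {n : ℕ} (G : Graph n)
    → (∃₂ λ a w → IsAlphaM G a × IsOmegaM G w × 2 ≤ a ⊔ w)
    → (M H : Subset n) → IsHat G M H
    → InBigM G M ⇔
        (IsModule G M × 2 ≤ ∣ M ∣ × LambdaCompleteOrEmpty G H
          × (∀ v → v ∈ M ⇔ (v ∈ H × InPi G H ⁅ v ⁆)))
proposition6 G _ M H hat = mk⇔ forward backward
  where
  forward : InBigM G M → IsModule G M × 2 ≤ ∣ M ∣ × LambdaCompleteOrEmpty G H
                         × (∀ v → v ∈ M ⇔ (v ∈ H × InPi G H ⁅ v ⁆))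
  forward ((mM , two , M-shape) , M-maximal) =
    mM , two , uniform⇒λ G F.uniform-quotient
    , λ v → mk⇔ (λ v∈M → F.M⊆H v∈M , F.M-singleton-part v∈M)
                (λ (v∈H , v-part) → F.singleton-part-in-M M-maximal v∈H v-part)
    where module F = Forward G hat mM two (proj₂ (homogeneous-value G M-shape))
  backward : IsModule G M × 2 ≤ ∣ M ∣ × LambdaCompleteOrEmpty G H
             × (∀ v → v ∈ M ⇔ (v ∈ H × InPi G H ⁅ v ⁆)) → InBigM G M
  backward (mM , two , λ-property , singletons) = B.in-𝕄 mM
    where module B = Backward G (proj₁ hat) (proj₁ (proj₂ hat)) two
                              (proj₂ (λ⇒uniform G λ-property)) singletons
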